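{- There exist an undirected weighted $n$-node graph $G$ and a single node pair $(s,t)$ such that every $2$-FT $(s,t)$ preserver of $G$ has $\Omega(n^2)$ edges. Moreover, any exact $2$-FT distance sensitivity oracle for a single pair $(s,t)$ in $n$-node undirected weighted graphs uses $\Omega(n^2)$ bits of space in the worst case.
   Context: A subgraph $H\subseteq G=(V,E)$ is a $2$-FT $(s,t)$ preserver if $\mathrm{dist}_{H\setminus F}(s,t)=\mathrm{dist}_{G\setminus F}(s,t)$ for every $F\subseteq E$ with $|F|\leq 2$. An exact $2$-FT distance sensitivity oracle for $(s,t)$ is a data structure built from $G$ that, given any $F\subseteq E$ with $|F|\leq 2$, returns $\mathrm{dist}_{G\setminus F}(s,t)$ exactly. -}

module Defs where

open import Data.Nat using (ℕ; zero; suc; _+_; _*_; _≤_; _<_; _<ᵇ_; _^_)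
open import Data.Fin using (Fin; toℕ)
open import Data.Fin.Properties using () renaming (_≟_ to _≟ᶠ_)
open import Data.Bool using (Bool; true; false; if_then_else_; _∧_; _∨_)
open import Data.Maybe using (Maybe; just; nothing)
open import Data.Product using (Σ; _×_; _,_; ∃)
open import Data.List using (List; []; _∷_; length; map; allFin; cartesianProduct)
open import Data.Nat.ListAction using (sum)
open import Data.List.Relation.Unary.All using (All)
open import Relation.Binary.PropositionalEquality using (_≡_)
open import Relation.Nullary using (¬_; ⌊_⌋)

Graph : ℕ → Set
Graph n = Fin n → Fin n → Maybe ℕ

record Undirected {n : ℕ} (G : Graph n) : Set where
  field
    symmetric : ∀ u v → G u v ≡ G v u
    loopless  : ∀ u → G u u ≡ nothing
    positive  : ∀ u v w → G u v ≡ just w → 1 ≤ w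

WeightsBoundedBy : {n : ℕ} → ℕ → Graph n → Set
WeightsBoundedBy W G = ∀ u v w → G u v ≡ just w → w ≤ W

_⊆ᴳ_ : {n : ℕ} → Graph n → Graph n → Set
H ⊆ᴳ G = ∀ u v w → H u v ≡ just w → G u v ≡ just w

IsEdge : {n : ℕ} → Graph n → Fin n × Fin n → Set
IsEdge G (u , v) = ∃ λ w → G u v ≡ just w

isJust? : Maybe ℕ → ℕ
isJust? nothing  = 0
isJust? (just _) = 1

edgeCount : {n : ℕ} → Graph n → ℕ
edgeCount {n} G =
  sum (map (λ p → edgeAt p) (cartesianProduct (allFin n) (allFin n)))
  where
  edgeAt : Fin n × Fin n → ℕ
  edgeAt (u , v) = if toℕ u <ᵇ toℕ v then isJust? (G u v) else 0

FaultSet : ℕ → Set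
FaultSet n = List (Fin n × Fin n)

hits : {n : ℕ} → FaultSet n → Fin n → Fin n → Bool
hits []             a b = false
hits ((u , v) ∷ F)  a b =
  ((⌊ a ≟ᶠ u ⌋ ∧ ⌊ b ≟ᶠ v ⌋) ∨ (⌊ a ≟ᶠ v ⌋ ∧ ⌊ b ≟ᶠ u ⌋)) ∨ hits F a b

_∖_ : {n : ℕ} → Graph n → FaultSet n → Graph n
(G ∖ F) a b = if hits F a b then nothing else G a b

ValidFaults : {n : ℕ} → Graph n → FaultSet n → Set
ValidFaults G F = length F ≤ 2 × All (IsEdge G) F

data Walk {n : ℕ} (G : Graph n) : Fin n → Fin n → ℕ → Set where
  [] : ∀ {u} → Walk G u u 0
  _∷_ : ∀ {u x v w d} → G u x ≡ just w → Walk G x v d → Walk G u v (w + d)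

-- IsDist G s t δ : δ is dist_G(s,t), where nothing means +∞ (t unreachable).
IsDist : {n : ℕ} → Graph n → Fin n → Fin n → Maybe ℕ → Set
IsDist G s t (just d) = Walk G s t d × (∀ d′ → Walk G s t d′ → d ≤ d′)
IsDist G s t nothing  = ∀ d → ¬ Walk G s t d

TwoFTPreserver : {n : ℕ} → Graph n → Fin n → Fin n → Graph n → Set
TwoFTPreserver G s t H =
  Undirected H × H ⊆ᴳ G ×
  (∀ F → ValidFaults G F → ∀ δ → IsDist (G ∖ F) s t δ → IsDist (H ∖ F) s t δ)

-- The oracle is a bit string  encode G  built from G, and a query algorithm
-- that, from the bit string alone and F, returns dist_{G∖F}(s,t).

record TwoFTOracle (n W : ℕ) (s t : Fin n) : Set where
  field
    encode : Graph n → List Bool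
    query  : List Bool → FaultSet n → Maybe ℕ
    correct : ∀ G → Undirected G → WeightsBoundedBy W G →
              ∀ F → ValidFaults G F →
              IsDist (G ∖ F) s t (query (encode G) F)

module Submission where

-- Two paths a₀ … a_m and b₀ … b_m of unit edges are joined by cross edges a_p b_q (p, q < m) of
-- weight M + 2(m − p) + 2(m − q), with M so large that no shortest path uses two cross edges.
-- Let s = a₀, t = b₀ and fail the path edges a_i a_{i+1} and b_j b_{j+1}.  A path crossing at
-- a_p b_q with p ≤ i, q ≤ j then costs (i − p) + (j − q) more than the path a₀ … a_i b_j … b₀,
-- so this path is the unique shortest one; a feasible potential certifies the bound.  Hence a
-- 2-FT preserver keeps all m² cross edges, and for the 2^{m²} graphs obtained by deleting cross
-- edges the answers to these m² queries recover the deleted set, so some graph needs ≥ m² bits.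
-- With n ∈ {2m + 2, 2m + 3}, both bounds are Ω(n²).

open import Defs
open import Data.Nat using (ℕ; zero; suc; _+_; _*_; _∸_; _≤_; _<_; _^_; z≤n; s≤s; s≤s⁻¹; _≤?_; _<?_; _<ᵇ_)
open import Data.Nat.Properties
open import Data.Nat.Tactic.RingSolver using (solve-∀)
open import Data.Nat.ListAction using (sum)
open import Data.Nat.ListAction.Properties using (sum-++)
open import Data.Fin using (Fin; toℕ; fromℕ<)
open import Data.Fin.Properties using (toℕ-injective; toℕ-fromℕ<) renaming (_≟_ to _≟ᶠ_)
open import Data.Bool using (Bool; true; false; if_then_else_; _∧_; _∨_; T)
import Data.Bool as Bool
open import Data.Bool.Properties using (∨-zeroʳ)
open import Data.Maybe using (Maybe; just; nothing)
open import Data.Product using (Σ; ∃; _×_; _,_; proj₁; proj₂)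
open import Data.Sum using (_⊎_; inj₁; inj₂)
import Data.Sum as Sum
open import Data.Empty using (⊥)
open import Data.List using (List; []; _∷_; length; map; _++_; tabulate; allFin; cartesianProduct; cartesianProductWith)
open import Data.List.Properties using (length-++; length-map; map-++; map-tabulate; map-∘)
open import Data.List.Relation.Unary.All using (All; []; _∷_)
import Data.List.Relation.Unary.All as All
import Data.List.Relation.Unary.All.Properties as All
open import Data.List.Relation.Unary.Any using (any?; satisfied; here; there)
open import Data.List.Relation.Unary.AllPairs using ([]; _∷_)
open import Data.List.Relation.Unary.Unique.Propositional using (Unique)
import Data.List.Relation.Unary.Unique.Propositional.Properties as Unique
open import Data.List.Membership.Propositional using (_∈_)
open import Data.Vec using (Vec; []; _∷_)
import Data.Vec as Vec
import Data.Vec.Properties as Vecₚ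
open import Function using (id; _∘_)
open import Function.Definitions using (Injective)
open import Relation.Binary.PropositionalEquality
open import Relation.Nullary using (¬_; yes; no; contradiction; ⌊_⌋)

-- Counting distinct bit strings

tailsAfter : Bool → List (List Bool) → List (List Bool)
tailsAfter b []              = []
tailsAfter b ([] ∷ xs)       = tailsAfter b xs
tailsAfter b ((b′ ∷ l) ∷ xs) with b Bool.≟ b′
... | yes _ = l ∷ tailsAfter b xs
... | no  _ = tailsAfter b xs

tailsAfter-∉ : ∀ {b l} xs → All (b ∷ l ≢_) xs → All (l ≢_) (tailsAfter b xs)
tailsAfter-∉         []              []       = []
tailsAfter-∉         ([] ∷ xs)       (_ ∷ ps) = tailsAfter-∉ xs ps
tailsAfter-∉ {b} ((b′ ∷ l′) ∷ xs) (p ∷ ps) with b Bool.≟ b′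
... | yes refl = (λ l≡l′ → p (cong (b ∷_) l≡l′)) ∷ tailsAfter-∉ xs ps
... | no  _    = tailsAfter-∉ xs ps

tailsAfter-unique : ∀ {b} xs → Unique xs → Unique (tailsAfter b xs)
tailsAfter-unique         []              []       = []
tailsAfter-unique         ([] ∷ xs)       (_ ∷ u)  = tailsAfter-unique xs u
tailsAfter-unique {b} ((b′ ∷ l) ∷ xs) (p ∷ u) with b Bool.≟ b′
... | yes refl = tailsAfter-∉ xs p ∷ tailsAfter-unique xs u
... | no  _    = tailsAfter-unique xs u

tailsAfter-shorter : ∀ {b L} xs → All (λ l → length l < suc L) xs →
                     All (λ l → length l < L) (tailsAfter b xs)
tailsAfter-shorter         []              []       = []
tailsAfter-shorter         ([] ∷ xs)       (_ ∷ ps) = tailsAfter-shorter xs ps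
tailsAfter-shorter {b} ((b′ ∷ l) ∷ xs) (p ∷ ps) with b Bool.≟ b′
... | yes _ = s≤s⁻¹ p ∷ tailsAfter-shorter xs ps
... | no  _ = tailsAfter-shorter xs ps

length-tailsAfter : ∀ xs → All ([] ≢_) xs →
  length xs ≡ length (tailsAfter true xs) + length (tailsAfter false xs)
length-tailsAfter []                  []       = refl
length-tailsAfter ([] ∷ xs)           (p ∷ _)  = contradiction refl p
length-tailsAfter ((true ∷ l) ∷ xs)   (_ ∷ ps) = cong suc (length-tailsAfter xs ps)
length-tailsAfter ((false ∷ l) ∷ xs)  (_ ∷ ps) =
  trans (cong suc (length-tailsAfter xs ps)) (sym (+-suc _ _))

-- A set of bit strings contains the empty string at most once; all others split by their head.
length-≤-tailsAfter : ∀ xs → Unique xs →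
  length xs ≤ suc (length (tailsAfter true xs) + length (tailsAfter false xs))
length-≤-tailsAfter []                 []      = z≤n
length-≤-tailsAfter ([] ∷ xs)          (p ∷ _) = s≤s (≤-reflexive (length-tailsAfter xs p))
length-≤-tailsAfter ((true ∷ l) ∷ xs)  (_ ∷ u) = s≤s (length-≤-tailsAfter xs u)
length-≤-tailsAfter ((false ∷ l) ∷ xs) (_ ∷ u) =
  ≤-trans (s≤s (length-≤-tailsAfter xs u)) (≤-reflexive (cong suc (sym (+-suc _ _))))

unique-shorter⇒length< : ∀ L xs → Unique xs → All (λ l → length l < L) xs → length xs < 2 ^ L
unique-shorter⇒length< zero    []       _ _        = s≤s z≤n
unique-shorter⇒length< zero    (_ ∷ _)  _ (() ∷ _)
unique-shorter⇒length< (suc L) xs       u shorter = begin-strict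
  length xs                 ≤⟨ length-≤-tailsAfter xs u ⟩
  suc (#true + #false)      <⟨ s≤s (≤-reflexive (sym (+-suc #true #false))) ⟩
  suc #true + suc #false    ≤⟨ +-mono-≤ (bound true) (bound false) ⟩
  2 ^ L + 2 ^ L             ≡⟨ cong (2 ^ L +_) (+-identityʳ _) ⟨
  2 ^ suc L                 ∎
  where
  open ≤-Reasoning
  #true #false : ℕ
  #true  = length (tailsAfter true xs)
  #false = length (tailsAfter false xs)
  bound : ∀ b → suc (length (tailsAfter b xs)) ≤ 2 ^ L
  bound b = unique-shorter⇒length< L (tailsAfter b xs)
              (tailsAfter-unique xs u) (tailsAfter-shorter xs shorter)

injective⇒long-image : ∀ {A : Set} L (f : A → List Bool) → Injective _≡_ _≡_ f →
  (xs : List A) → Unique xs → 2 ^ L ≤ length xs → ∃ λ x → L ≤ length (f x)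
injective⇒long-image L f f-inj xs u many with any? (λ x → L ≤? length (f x)) xs
... | yes long = satisfied long
... | no ¬long = contradiction many (<⇒≱ (begin-strict
  length xs         ≡⟨ length-map f xs ⟨
  length (map f xs) <⟨ unique-shorter⇒length< L (map f xs) (Unique.map⁺ f-inj u)
                         (All.map⁺ (All.map ≰⇒> (All.¬Any⇒All¬ xs ¬long))) ⟩
  2 ^ L             ∎))
  where open ≤-Reasoning

length-cartesianProductWith : ∀ {A B C : Set} (f : A → B → C) xs ys →
  length (cartesianProductWith f xs ys) ≡ length xs * length ys
length-cartesianProductWith f []       ys = refl
length-cartesianProductWith f (x ∷ xs) ys = begin
  length (map (f x) ys ++ cartesianProductWith f xs ys)          ≡⟨ length-++ (map (f x) ys) ⟩
  length (map (f x) ys) + length (cartesianProductWith f xs ys)  ≡⟨ cong₂ _+_ (length-map (f x) ys) (length-cartesianProductWith f xs ys) ⟩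
  length ys + length xs * length ys                              ∎
  where open ≡-Reasoning

vectors : ∀ {A : Set} → List A → (k : ℕ) → List (Vec A k)
vectors xs zero    = [] ∷ []
vectors xs (suc k) = cartesianProductWith _∷_ xs (vectors xs k)

length-vectors : ∀ {A : Set} (xs : List A) k → length (vectors xs k) ≡ length xs ^ k
length-vectors xs zero    = refl
length-vectors xs (suc k) =
  trans (length-cartesianProductWith _∷_ xs (vectors xs k)) (cong (length xs *_) (length-vectors xs k))

vectors-unique : ∀ {A : Set} {xs : List A} k → Unique xs → Unique (vectors xs k)
vectors-unique zero    _ = [] ∷ []
vectors-unique (suc k) u = Unique.cartesianProductWith⁺ _∷_ Vecₚ.∷-injective u (vectors-unique k u)

module _ {n : ℕ} where

  Feasible : Graph n → (Fin n → ℕ) → Set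
  Feasible K φ = ∀ u v w → K u v ≡ just w → φ u ≤ w + φ v

  feasible⇒walk-≥ : ∀ {K φ} → Feasible K φ → ∀ {u v d} → Walk K u v d → φ u ≤ d + φ v
  feasible⇒walk-≥ feasible [] = ≤-refl
  feasible⇒walk-≥ {φ = φ} feasible (_∷_ {u} {x} {v} {w} {d} e walk) = begin
    φ u            ≤⟨ feasible u x w e ⟩
    w + φ x        ≤⟨ +-monoʳ-≤ w (feasible⇒walk-≥ feasible walk) ⟩
    w + (d + φ v)  ≡⟨ +-assoc w d (φ v) ⟨
    w + d + φ v    ∎
    where open ≤-Reasoning

  IsDist-minimal-walk : ∀ {K : Graph n} {s t δ D} → IsDist K s t δ → Walk K s t D →
                        (∀ d → Walk K s t d → D ≤ d) → δ ≡ just D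
  IsDist-minimal-walk {δ = nothing} unreachable     walk _       = contradiction walk (unreachable _)
  IsDist-minimal-walk {δ = just d} (walk′ , least) walk minimal =
    cong just (≤-antisym (least _ walk) (minimal d walk′))

  ∖-edge⁻ : ∀ (K : Graph n) F u v {w} → (K ∖ F) u v ≡ just w → hits F u v ≡ false × K u v ≡ just w
  ∖-edge⁻ K F u v e with hits F u v
  ... | false = refl , e

  ∖-edge⁺ : ∀ (K : Graph n) F u v {w} → hits F u v ≡ false → K u v ≡ just w → (K ∖ F) u v ≡ just w
  ∖-edge⁺ K F u v miss e rewrite miss = e

  private
    ≟-matches : ∀ (u v : Fin n) → (⌊ u ≟ᶠ u ⌋ ∧ ⌊ v ≟ᶠ v ⌋) ≡ true
    ≟-matches u v with u ≟ᶠ u | v ≟ᶠ v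
    ... | yes _ | yes _ = refl
    ... | no u≢u | _    = contradiction refl u≢u
    ... | yes _ | no v≢v = contradiction refl v≢v

    ≟-mismatches : ∀ {u v a b : Fin n} → (u , v) ≢ (a , b) → (⌊ u ≟ᶠ a ⌋ ∧ ⌊ v ≟ᶠ b ⌋) ≡ false
    ≟-mismatches {u} {v} {a} {b} ne with u ≟ᶠ a | v ≟ᶠ b
    ... | yes refl | yes refl = contradiction refl ne
    ... | yes _    | no _     = refl
    ... | no _     | _        = refl

    swap-≢ : ∀ {u v a b : Fin n} → (v , u) ≢ (a , b) → (u , v) ≢ (b , a)
    swap-≢ vu≢ab refl = vu≢ab refl

  hits-∈ : ∀ {F u v} → (u , v) ∈ F ⊎ (v , u) ∈ F → hits F u v ≡ true
  hits-∈ {_ ∷ F} {u} {v} (inj₁ (here refl)) rewrite ≟-matches u v = refl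
  hits-∈ {_ ∷ F} {u} {v} (inj₂ (here refl)) rewrite ≟-matches u v = cong (_∨ hits F u v) (∨-zeroʳ _)
  hits-∈ {_ ∷ F} (inj₁ (there e)) rewrite hits-∈ {F} (inj₁ e) = ∨-zeroʳ _
  hits-∈ {_ ∷ F} (inj₂ (there e)) rewrite hits-∈ {F} (inj₂ e) = ∨-zeroʳ _

  hits-∉ : ∀ {F u v} → All (λ e → (u , v) ≢ e × (v , u) ≢ e) F → hits F u v ≡ false
  hits-∉ []                       = refl
  hits-∉ ((uv≢ab , vu≢ab) ∷ rest) =
    cong₂ _∨_ (cong₂ _∨_ (≟-mismatches uv≢ab) (≟-mismatches (swap-≢ vu≢ab))) (hits-∉ rest)

-- Counting edges

sum-map-*ˡ : ∀ {A : Set} k (f : A → ℕ) xs → sum (map (λ x → k * f x) xs) ≡ k * sum (map f xs)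
sum-map-*ˡ k f []       = sym (*-zeroʳ k)
sum-map-*ˡ k f (x ∷ xs) =
  trans (cong (k * f x +_) (sum-map-*ˡ k f xs)) (sym (*-distribˡ-+ k (f x) _))

sum-cartesianProduct : ∀ {A B : Set} (f : A → ℕ) (g : B → ℕ) xs ys →
  sum (map (λ p → f (proj₁ p) * g (proj₂ p)) (cartesianProduct xs ys)) ≡ sum (map f xs) * sum (map g ys)
sum-cartesianProduct f g []       ys = refl
sum-cartesianProduct f g (x ∷ xs) ys = begin
  sum (map fg (map (x ,_) ys ++ cartesianProduct xs ys))
    ≡⟨ cong sum (map-++ fg (map (x ,_) ys) (cartesianProduct xs ys)) ⟩
  sum (map fg (map (x ,_) ys) ++ map fg (cartesianProduct xs ys))
    ≡⟨ sum-++ (map fg (map (x ,_) ys)) _ ⟩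
  sum (map fg (map (x ,_) ys)) + sum (map fg (cartesianProduct xs ys))
    ≡⟨ cong₂ _+_ (trans (cong sum (sym (map-∘ ys))) (sum-map-*ˡ (f x) g ys))
                 (sum-cartesianProduct f g xs ys) ⟩
  f x * sum (map g ys) + sum (map f xs) * sum (map g ys)
    ≡⟨ *-distribʳ-+ (sum (map g ys)) (f x) _ ⟨
  (f x + sum (map f xs)) * sum (map g ys) ∎
  where
  open ≡-Reasoning
  fg : _ × _ → ℕ
  fg p = f (proj₁ p) * g (proj₂ p)

sum-map-mono : ∀ {A : Set} {f g : A → ℕ} xs → (∀ x → f x ≤ g x) → sum (map f xs) ≤ sum (map g xs)
sum-map-mono []       _   = z≤n
sum-map-mono (x ∷ xs) f≤g = +-mono-≤ (f≤g x) (sum-map-mono xs f≤g)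

edgeCount-≥-product : ∀ {n} (H : Graph n) (f g : Fin n → ℕ) →
  (∀ u v → f u * g v ≤ (if toℕ u <ᵇ toℕ v then isJust? (H u v) else 0)) →
  sum (map f (allFin n)) * sum (map g (allFin n)) ≤ edgeCount H
edgeCount-≥-product {n} H f g f*g≤edge = begin
  sum (map f (allFin n)) * sum (map g (allFin n))
    ≡⟨ sum-cartesianProduct f g (allFin n) (allFin n) ⟨
  sum (map (λ p → f (proj₁ p) * g (proj₂ p)) (cartesianProduct (allFin n) (allFin n)))
    ≤⟨ sum-map-mono (cartesianProduct (allFin n) (allFin n)) (λ p → f*g≤edge (proj₁ p) (proj₂ p)) ⟩
  edgeCount H ∎
  where open ≤-Reasoning

indicator : ℕ → ℕ → ℕ → ℕ
indicator (suc lo) len       zero    = 0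
indicator (suc lo) len       (suc x) = indicator lo len x
indicator zero     zero      x       = 0
indicator zero     (suc len) zero    = 1
indicator zero     (suc len) (suc x) = indicator zero len x

indicator-cases : ∀ lo len x → indicator lo len x ≡ 0 ⊎ (indicator lo len x ≡ 1 × lo ≤ x × x < lo + len)
indicator-cases (suc lo) len zero = inj₁ refl
indicator-cases (suc lo) len (suc x) with indicator-cases lo len x
... | inj₁ e             = inj₁ e
... | inj₂ (e , lo≤x , x<) = inj₂ (e , s≤s lo≤x , s≤s x<)
indicator-cases zero zero      x       = inj₁ refl
indicator-cases zero (suc len) zero    = inj₂ (refl , z≤n , s≤s z≤n)
indicator-cases zero (suc len) (suc x) with indicator-cases zero len x
... | inj₁ e           = inj₁ e
... | inj₂ (e , _ , x<) = inj₂ (e , z≤n , s≤s x<)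

sum-indicator : ∀ n lo len → lo + len ≤ n → len ≤ sum (map (indicator lo len ∘ toℕ) (allFin n))
sum-indicator n lo len bound =
  subst (λ xs → len ≤ sum xs) (sym (map-tabulate {n = n} id (indicator lo len ∘ toℕ))) (go n lo len bound)
  where
  go : ∀ n lo len → lo + len ≤ n → len ≤ sum (tabulate {n = n} (indicator lo len ∘ toℕ))
  go n       lo       zero      _         = z≤n
  go (suc n) zero     (suc len) (s≤s le) = s≤s (go n zero len le)
  go (suc n) (suc lo) (suc len) (s≤s le) = go n lo (suc len) le

edgeCount-≥-intervals : ∀ {n} (H : Graph n) lo₁ len₁ lo₂ len₂ → lo₁ + len₁ ≤ lo₂ → lo₂ + len₂ ≤ n →
  (∀ u v → toℕ u < lo₁ + len₁ → lo₂ ≤ toℕ v → toℕ v < lo₂ + len₂ → IsEdge H (u , v)) →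
  len₁ * len₂ ≤ edgeCount H
edgeCount-≥-intervals {n} H lo₁ len₁ lo₂ len₂ disjoint bounded adjacent = begin
  len₁ * len₂
    ≤⟨ *-mono-≤ (sum-indicator n lo₁ len₁ (≤-trans disjoint (≤-trans (m≤m+n lo₂ len₂) bounded)))
                (sum-indicator n lo₂ len₂ bounded) ⟩
  sum (map f (allFin n)) * sum (map g (allFin n))
    ≤⟨ edgeCount-≥-product H f g f*g≤edge ⟩
  edgeCount H ∎
  where
  open ≤-Reasoning
  f g : Fin n → ℕ
  f = indicator lo₁ len₁ ∘ toℕ
  g = indicator lo₂ len₂ ∘ toℕ

  f*g≤edge : ∀ u v → f u * g v ≤ (if toℕ u <ᵇ toℕ v then isJust? (H u v) else 0)
  f*g≤edge u v with indicator-cases lo₁ len₁ (toℕ u) | indicator-cases lo₂ len₂ (toℕ v)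
  ... | inj₁ fu≡0 | _ rewrite fu≡0 = z≤n
  ... | inj₂ _ | inj₁ gv≡0 rewrite gv≡0 | *-zeroʳ (f u) = z≤n
  ... | inj₂ (fu≡1 , _ , u<) | inj₂ (gv≡1 , lo₂≤v , v<) rewrite fu≡1 | gv≡1
    with toℕ u <ᵇ toℕ v in u<ᵇv | adjacent u v u< lo₂≤v v<
  ... | true  | w , Huv rewrite Huv = ≤-refl
  ... | false | _ = contradiction (subst T u<ᵇv (<⇒<ᵇ (≤-trans u< (≤-trans disjoint lo₂≤v)))) id

-- The lower-bound graphs

m∸n≤1+m∸[1+n] : ∀ m n → m ∸ n ≤ suc (m ∸ suc n)
m∸n≤1+m∸[1+n] zero    zero    = z≤n
m∸n≤1+m∸[1+n] zero    (suc n) = z≤n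
m∸n≤1+m∸[1+n] (suc m) zero    = ≤-refl
m∸n≤1+m∸[1+n] (suc m) (suc n) = m∸n≤1+m∸[1+n] m n

ε≤∸+∸ : ∀ {ε i j p q} → p ≤ i → q ≤ j → ε ≤ 1 → (ε ≡ 1 → ¬ (p ≡ i × q ≡ j)) → ε ≤ (i ∸ p) + (j ∸ q)
ε≤∸+∸ {zero} _ _ _ _ = z≤n
ε≤∸+∸ {suc zero} {i} {j} {p} {q} p≤i q≤j _ excluded with i ∸ p in i-p | j ∸ q in j-q
... | suc _ | _     = s≤s z≤n
... | zero  | suc _ = s≤s z≤n
... | zero  | zero  =
  contradiction (≤-antisym p≤i (m∸n≡0⇒m≤n i-p) , ≤-antisym q≤j (m∸n≡0⇒m≤n j-q)) (excluded refl)
ε≤∸+∸ {suc (suc _)} _ _ (s≤s ()) _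

lookupOr : ∀ {A : Set} {k} → A → Vec A k → ℕ → A
lookupOr d []       _       = d
lookupOr d (x ∷ xs) zero    = x
lookupOr d (x ∷ xs) (suc p) = lookupOr d xs p

lookupOr-injective : ∀ {A : Set} {k} d (xs ys : Vec A k) →
                     (∀ p → p < k → lookupOr d xs p ≡ lookupOr d ys p) → xs ≡ ys
lookupOr-injective d []       []       _    = refl
lookupOr-injective d (x ∷ xs) (y ∷ ys) same =
  cong₂ _∷_ (same 0 (s≤s z≤n)) (lookupOr-injective d xs ys (λ p p<k → same (suc p) (s≤s p<k)))

CrossPattern : Set
CrossPattern = ℕ → ℕ → Bool

full : CrossPattern
full _ _ = true

pathEdge : ℕ → ℕ → Maybe ℕ
pathEdge zero       (suc zero) = just 1
pathEdge (suc a)    (suc b)    = pathEdge a b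
pathEdge (suc zero) zero       = just 1
pathEdge _          _          = nothing

pathEdge-inv : ∀ a b {w} → pathEdge a b ≡ just w → w ≡ 1 × (b ≡ suc a ⊎ a ≡ suc b)
pathEdge-inv zero          (suc zero)    refl = refl , inj₁ refl
pathEdge-inv (suc zero)    zero          refl = refl , inj₂ refl
pathEdge-inv (suc a)       (suc b)       e    with pathEdge-inv a b e
... | w≡1 , inj₁ refl = w≡1 , inj₁ refl
... | w≡1 , inj₂ refl = w≡1 , inj₂ refl
pathEdge-inv zero          zero          ()
pathEdge-inv zero          (suc (suc b)) ()
pathEdge-inv (suc (suc a)) zero          ()

pathEdge-sym : ∀ a b → pathEdge a b ≡ pathEdge b a
pathEdge-sym zero          zero          = refl
pathEdge-sym zero          (suc zero)    = refl
pathEdge-sym zero          (suc (suc b)) = refl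
pathEdge-sym (suc zero)    zero          = refl
pathEdge-sym (suc (suc a)) zero          = refl
pathEdge-sym (suc a)       (suc b)       = pathEdge-sym a b

pathEdge-irrefl : ∀ a → pathEdge a a ≡ nothing
pathEdge-irrefl zero    = refl
pathEdge-irrefl (suc a) = pathEdge-irrefl a

pathEdge-suc : ∀ a → pathEdge a (suc a) ≡ just 1
pathEdge-suc zero    = refl
pathEdge-suc (suc a) = pathEdge-suc a

pathEdge-pred : ∀ a → pathEdge (suc a) a ≡ just 1
pathEdge-pred a = trans (pathEdge-sym (suc a) a) (pathEdge-suc a)

-- Two paths a₀ … a_m (labels 0 … m) and b₀ … b_m (labels m+1 … 2m+1) of unit edges, and a
-- cross edge a_p b_q of weight M + 2(m−p) + 2(m−q) for each p, q < m selected by the pattern.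
module LowerBoundGraph (m : ℕ) where

  data Kind (x : ℕ) : Set where
    pathA    : x ≤ m → Kind x
    pathB    : ∀ q → q ≤ m → x ≡ suc (m + q) → Kind x
    isolated : ¬ x ≤ m → ¬ (x ∸ suc m ≤ m) → Kind x

  kind : ∀ x → Kind x
  kind x with x ≤? m
  ... | yes x≤m = pathA x≤m
  ... | no x≰m with x ∸ suc m ≤? m
  ...   | yes q≤m = pathB (x ∸ suc m) q≤m (sym (m+[n∸m]≡n (≰⇒> x≰m)))
  ...   | no q≰m  = isolated x≰m q≰m

  A-B-disjoint : ∀ {x q} → x ≤ m → x ≢ suc (m + q)
  A-B-disjoint {q = q} x≤m refl = 1+n≰n (≤-trans (s≤s (m≤m+n m q)) x≤m)

  B-label-injective : ∀ {q q′} → suc (m + q) ≡ suc (m + q′) → q ≡ q′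
  B-label-injective {q} {q′} e = +-cancelˡ-≡ m q q′ (suc-injective e)

  B-label-∸ : ∀ {q} → q ≤ m → suc (m + q) ∸ suc m ≤ m
  B-label-∸ {q} = subst (_≤ m) (sym (m+n∸m≡n m q))

  -- M = 6m + 1 is what makes 2M exceed every potential of an A-vertex (φA≤crossWeight+2M).
  M : ℕ
  M = suc (6 * m)

  crossWeight : ℕ → ℕ → ℕ
  crossWeight p q = M + 2 * (m ∸ p) + 2 * (m ∸ q)

  maxWeight : ℕ
  maxWeight = M + 2 * m + 2 * m

  M≤crossWeight : ∀ p q → M ≤ crossWeight p q
  M≤crossWeight p q = ≤-trans (m≤m+n M _) (m≤m+n _ _)

  crossWeight≤maxWeight : ∀ p q → crossWeight p q ≤ maxWeight
  crossWeight≤maxWeight p q =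
    +-mono-≤ (+-monoʳ-≤ M (*-monoʳ-≤ 2 (m∸n≤m m p))) (*-monoʳ-≤ 2 (m∸n≤m m q))

  crossEdge : CrossPattern → ℕ → ℕ → Maybe ℕ
  crossEdge c p q = if c p q ∧ ⌊ p <? m ⌋ ∧ ⌊ q <? m ⌋ then just (crossWeight p q) else nothing

  crossEdge-inv : ∀ c p q {w} → crossEdge c p q ≡ just w → w ≡ crossWeight p q × p < m × q < m
  crossEdge-inv c p q e with c p q | p <? m | q <? m
  crossEdge-inv c p q refl | true | yes p<m | yes q<m = refl , p<m , q<m
  crossEdge-inv c p q ()   | true | yes _   | no _
  crossEdge-inv c p q ()   | true | no _    | _
  crossEdge-inv c p q ()   | false | _      | _

  crossEdge-present : ∀ c p q → c p q ≡ true → p < m → q < m → crossEdge c p q ≡ just (crossWeight p q)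
  crossEdge-present c p q cpq p<m q<m with c p q | p <? m | q <? m
  ... | true  | yes _   | yes _   = refl
  ... | true  | yes _   | no q≮m  = contradiction q<m q≮m
  ... | true  | no p≮m  | _       = contradiction p<m p≮m
  crossEdge-present c p q () p<m q<m | false | _ | _

  crossEdge-absent : ∀ c p q → c p q ≡ false → crossEdge c p q ≡ nothing
  crossEdge-absent c p q cpq rewrite cpq = refl

  edge : CrossPattern → ∀ x y → Kind x → Kind y → Maybe ℕ
  edge c x y (pathA _)     (pathA _)      = pathEdge x y
  edge c x y (pathA _)     (pathB q _ _)  = crossEdge c x q
  edge c x y (pathB q _ _) (pathA _)      = crossEdge c y q
  edge c x y (pathB q _ _) (pathB q′ _ _) = pathEdge q q′
  edge c x y (pathA _)     (isolated _ _) = nothing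
  edge c x y (pathB _ _ _) (isolated _ _) = nothing
  edge c x y (isolated _ _) _             = nothing

  edge-sym : ∀ c x y (kx : Kind x) (ky : Kind y) → edge c x y kx ky ≡ edge c y x ky kx
  edge-sym c x y (pathA _)      (pathA _)      = pathEdge-sym x y
  edge-sym c x y (pathA _)      (pathB _ _ _)  = refl
  edge-sym c x y (pathA _)      (isolated _ _) = refl
  edge-sym c x y (pathB _ _ _)  (pathA _)      = refl
  edge-sym c x y (pathB q _ _)  (pathB q′ _ _) = pathEdge-sym q q′
  edge-sym c x y (pathB _ _ _)  (isolated _ _) = refl
  edge-sym c x y (isolated _ _) (pathA _)      = refl
  edge-sym c x y (isolated _ _) (pathB _ _ _)  = refl
  edge-sym c x y (isolated _ _) (isolated _ _) = refl

  edge-irrefl : ∀ c x (k k′ : Kind x) → edge c x x k k′ ≡ nothing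
  edge-irrefl c x (pathA _)      (pathA _)       = pathEdge-irrefl x
  edge-irrefl c x (pathA x≤m)    (pathB _ _ e)   = contradiction e (A-B-disjoint x≤m)
  edge-irrefl c x (pathA _)      (isolated _ _)  = refl
  edge-irrefl c x (pathB _ _ e)  (pathA x≤m)     = contradiction e (A-B-disjoint x≤m)
  edge-irrefl c x (pathB q _ e)  (pathB q′ _ e′) rewrite B-label-injective (trans (sym e) e′) =
    pathEdge-irrefl q′
  edge-irrefl c x (pathB _ _ _)  (isolated _ _)  = refl
  edge-irrefl c x (isolated _ _) _               = refl

  edge-weight : ∀ c x y (kx : Kind x) (ky : Kind y) {w} → edge c x y kx ky ≡ just w →
                1 ≤ w × w ≤ maxWeight
  edge-weight c x y (pathA _)     (pathA _)      e with pathEdge-inv x y e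
  ... | refl , _ = ≤-refl , s≤s z≤n
  edge-weight c x y (pathA _)     (pathB q _ _)  e with crossEdge-inv c x q e
  ... | refl , _ = s≤s z≤n , crossWeight≤maxWeight x q
  edge-weight c x y (pathB q _ _) (pathA _)      e with crossEdge-inv c y q e
  ... | refl , _ = s≤s z≤n , crossWeight≤maxWeight y q
  edge-weight c x y (pathB q _ _) (pathB q′ _ _) e with pathEdge-inv q q′ e
  ... | refl , _ = ≤-refl , s≤s z≤n

  edge-⊆-full : ∀ c x y (kx : Kind x) (ky : Kind y) {w} → edge c x y kx ky ≡ just w → edge full x y kx ky ≡ just w
  edge-⊆-full c x y (pathA _)     (pathA _)     e = e
  edge-⊆-full c x y (pathA _)     (pathB q _ _) e with crossEdge-inv c x q e
  ... | refl , x<m , q<m = crossEdge-present full x q refl x<m q<m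
  edge-⊆-full c x y (pathB q _ _) (pathA _)     e with crossEdge-inv c y q e
  ... | refl , y<m , q<m = crossEdge-present full y q refl y<m q<m
  edge-⊆-full c x y (pathB _ _ _) (pathB _ _ _) e = e

  edge-A-suc : ∀ c x (kx : Kind x) (kx′ : Kind (suc x)) → suc x ≤ m → edge c x (suc x) kx kx′ ≡ just 1
  edge-A-suc c x (pathA _)      (pathA _)       _     = pathEdge-suc x
  edge-A-suc c x (pathA _)      (pathB _ _ e)   x<m   = contradiction e (A-B-disjoint x<m)
  edge-A-suc c x (pathA _)      (isolated x≰m _) x<m = contradiction x<m x≰m
  edge-A-suc c x (pathB _ _ e)  _               x<m   = contradiction e (A-B-disjoint (<⇒≤ x<m))
  edge-A-suc c x (isolated x≰m _) _             x<m   = contradiction (<⇒≤ x<m) x≰m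

  edge-B : ∀ c q q′ (k : Kind (suc (m + q))) (k′ : Kind (suc (m + q′))) → q ≤ m → q′ ≤ m →
           edge c _ _ k k′ ≡ pathEdge q q′
  edge-B c q q′ (pathB _ _ e) (pathB _ _ e′) _ _
    with B-label-injective e | B-label-injective e′
  ... | refl | refl = refl
  edge-B c q q′ (pathA x≤m)      _                _   _    = contradiction refl (A-B-disjoint x≤m)
  edge-B c q q′ (isolated _ q≰m) _                q≤m _    = contradiction (B-label-∸ q≤m) q≰m
  edge-B c q q′ (pathB _ _ _)    (pathA x≤m)      _   _    = contradiction refl (A-B-disjoint x≤m)
  edge-B c q q′ (pathB _ _ _)    (isolated _ q≰m) _   q′≤m = contradiction (B-label-∸ q′≤m) q≰m

  edge-cross : ∀ c p q (kp : Kind p) (kq : Kind (suc (m + q))) → p < m → q < m →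
               edge c p (suc (m + q)) kp kq ≡ crossEdge c p q
  edge-cross c p q (pathA _)        (pathB _ _ e)    _   _   with B-label-injective e
  ... | refl = refl
  edge-cross c p q (pathA _)        (pathA x≤m)      _   _   = contradiction refl (A-B-disjoint x≤m)
  edge-cross c p q (pathA _)        (isolated _ q≰m) _   q<m = contradiction (B-label-∸ (<⇒≤ q<m)) q≰m
  edge-cross c p q (pathB _ _ e)    _                p<m _   = contradiction e (A-B-disjoint (<⇒≤ p<m))
  edge-cross c p q (isolated p≰m _) _                p<m _   = contradiction (<⇒≤ p<m) p≰m

  -- φ estimates the distance to t = b₀ in the graph with the two faults a_i a_{i+1} and
  -- b_j b_{j+1}: before a fault one can walk along the path (A: to a_i, across to b_j, down B),
  -- behind it one needs a cross edge (≥ M) or, on B, two of them (≥ 2M).  With ε = 1 it also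
  -- accounts for the cross edge a_i b_j being absent.
  module Potential (i j ε : ℕ) (i<m : i < m) (j<m : j < m) (ε≤1 : ε ≤ 1) where

    W : ℕ
    W = crossWeight i j

    φA : ℕ → ℕ
    φA x = (i ∸ x) + (W + j) + ε

    φ : ∀ x → Kind x → ℕ
    φ x (pathA _) with x ≤? i
    ... | yes _ = φA x
    ... | no  _ = M
    φ x (pathB q _ _) with q ≤? j
    ... | yes _ = q
    ... | no  _ = M + M
    φ x (isolated _ _) = 0

    M≤φA : ∀ x → M ≤ φA x
    M≤φA x = ≤-trans (M≤crossWeight i j) (≤-trans (m≤m+n W j) (≤-trans (m≤n+m _ (i ∸ x)) (m≤m+n _ ε)))

    -- The slack of the cross edge a_p b_q (p ≤ i, q ≤ j) is (i − p) + (j − q) − ε, since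
    -- crossWeight p q = W + 2 (i − p) + 2 (j − q).
    cross-slack : ∀ p q → p ≤ i → q ≤ j → ε ≤ (i ∸ p) + (j ∸ q) → φA p ≤ crossWeight p q + q
    cross-slack p q p≤i q≤j ε≤ = begin
      (i ∸ p) + (W + j) + ε
        ≤⟨ +-monoʳ-≤ ((i ∸ p) + (W + j)) ε≤ ⟩
      (i ∸ p) + (W + j) + ((i ∸ p) + (j ∸ q))
        ≡⟨ cong (λ z → (i ∸ p) + (W + z) + ((i ∸ p) + (j ∸ q))) (m∸n+n≡m q≤j) ⟨
      (i ∸ p) + (W + ((j ∸ q) + q)) + ((i ∸ p) + (j ∸ q))
        ≡⟨ regroup M (m ∸ i) (m ∸ j) (i ∸ p) (j ∸ q) q ⟩
      M + 2 * ((m ∸ i) + (i ∸ p)) + 2 * ((m ∸ j) + (j ∸ q)) + q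
        ≡⟨ cong₂ (λ a b → M + 2 * a + 2 * b + q) (∸-split p≤i (<⇒≤ i<m)) (∸-split q≤j (<⇒≤ j<m)) ⟩
      crossWeight p q + q ∎
      where
      open ≤-Reasoning
      regroup : ∀ M X Y A B q → A + ((M + 2 * X + 2 * Y) + (B + q)) + (A + B) ≡ (M + 2 * (X + A) + 2 * (Y + B)) + q
      regroup = solve-∀
      ∸-split : ∀ {p i} → p ≤ i → i ≤ m → (m ∸ i) + (i ∸ p) ≡ m ∸ p
      ∸-split {p} {i} p≤i i≤m = trans (sym (+-∸-assoc (m ∸ i) p≤i)) (cong (_∸ p) (m∸n+n≡m i≤m))

    φA≤crossWeight+2M : ∀ p q → φA p ≤ crossWeight p q + (M + M)
    φA≤crossWeight+2M p q = begin
      (i ∸ p) + (W + j) + ε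
        ≤⟨ +-mono-≤ (+-mono-≤ (≤-trans (m∸n≤m i p) (<⇒≤ i<m))
                              (+-mono-≤ (crossWeight≤maxWeight i j) (<⇒≤ j<m))) ε≤1 ⟩
      m + (maxWeight + m) + 1  ≡⟨ twice-M m ⟩
      M + M                    ≤⟨ m≤n+m (M + M) (crossWeight p q) ⟩
      crossWeight p q + (M + M) ∎
      where
      open ≤-Reasoning
      twice-M : ∀ m → m + ((1 + 6 * m + 2 * m + 2 * m) + m) + 1 ≡ (1 + 6 * m) + (1 + 6 * m)
      twice-M = solve-∀

    φ-A-suc : ∀ x (hx : x ≤ m) (hx′ : suc x ≤ m) → x ≢ i → φ x (pathA hx) ≤ 1 + φ (suc x) (pathA hx′)
    φ-A-suc x hx hx′ x≢i with x ≤? i | suc x ≤? i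
    ... | yes _   | yes _   = +-monoˡ-≤ ε (+-monoˡ-≤ (W + j) (m∸n≤1+m∸[1+n] i x))
    ... | yes x≤i | no  x≮i = contradiction (≤-antisym x≤i (≮⇒≥ x≮i)) x≢i
    ... | no  x≰i | yes x<i = contradiction (<⇒≤ x<i) x≰i
    ... | no  _   | no  _   = n≤1+n M

    φ-A-pred : ∀ y (hy′ : suc y ≤ m) (hy : y ≤ m) → y ≢ i → φ (suc y) (pathA hy′) ≤ 1 + φ y (pathA hy)
    φ-A-pred y hy′ hy y≢i with suc y ≤? i | y ≤? i
    ... | yes _   | yes _   = ≤-trans (+-monoˡ-≤ ε (+-monoˡ-≤ (W + j) (∸-monoʳ-≤ i (n≤1+n y)))) (n≤1+n _)
    ... | yes y<i | no  y≰i = contradiction (<⇒≤ y<i) y≰i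
    ... | no  y≮i | yes y≤i = contradiction (≤-antisym y≤i (≮⇒≥ y≮i)) y≢i
    ... | no  _   | no  _   = n≤1+n M

    φ-B-suc : ∀ q x y (hq : q ≤ m) (hq′ : suc q ≤ m) e e′ → q ≢ j →
              φ x (pathB q hq e) ≤ 1 + φ y (pathB (suc q) hq′ e′)
    φ-B-suc q x y hq hq′ e e′ q≢j with q ≤? j | suc q ≤? j
    ... | yes _   | yes _   = ≤-trans (n≤1+n q) (n≤1+n _)
    ... | yes q≤j | no  q≮j = contradiction (≤-antisym q≤j (≮⇒≥ q≮j)) q≢j
    ... | no  q≰j | yes q<j = contradiction (<⇒≤ q<j) q≰j
    ... | no  _   | no  _   = n≤1+n _

    φ-B-pred : ∀ q x y (hq′ : suc q ≤ m) (hq : q ≤ m) e′ e → q ≢ j →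
               φ x (pathB (suc q) hq′ e′) ≤ 1 + φ y (pathB q hq e)
    φ-B-pred q x y hq′ hq e′ e q≢j with suc q ≤? j | q ≤? j
    ... | yes _   | yes _   = ≤-refl
    ... | yes q<j | no  q≰j = contradiction (<⇒≤ q<j) q≰j
    ... | no  q≮j | yes q≤j = contradiction (≤-antisym q≤j (≮⇒≥ q≮j)) q≢j
    ... | no  _   | no  _   = n≤1+n _

    φ-cross-AB : ∀ x q y (hx : x ≤ m) (hq : q ≤ m) e → (ε ≡ 1 → ¬ (x ≡ i × q ≡ j)) →
                 φ x (pathA hx) ≤ crossWeight x q + φ y (pathB q hq e)
    φ-cross-AB x q y hx hq e excluded with x ≤? i | q ≤? j
    ... | yes x≤i | yes q≤j = cross-slack x q x≤i q≤j (ε≤∸+∸ x≤i q≤j ε≤1 excluded)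
    ... | yes _   | no  _   = φA≤crossWeight+2M x q
    ... | no  _   | _       = ≤-trans (M≤crossWeight x q) (m≤m+n _ _)

    φ-cross-BA : ∀ q y x (hy : y ≤ m) (hq : q ≤ m) e → q < m →
                 φ x (pathB q hq e) ≤ crossWeight y q + φ y (pathA hy)
    φ-cross-BA q y x hy hq e q<m with q ≤? j | y ≤? i
    ... | yes _ | _     = ≤-trans (<⇒≤ q<m) (≤-trans m≤M (≤-trans (M≤crossWeight y q) (m≤m+n _ _)))
      where
      m≤M : m ≤ M
      m≤M = ≤-trans (m≤m+n m (5 * m)) (n≤1+n _)
    ... | no  _ | yes _ = +-mono-≤ (M≤crossWeight y q) (M≤φA y)
    ... | no  _ | no  _ = +-monoˡ-≤ M (M≤crossWeight y q)

    φ-feasible : ∀ x y (kx : Kind x) (ky : Kind y) w → edge full x y kx ky ≡ just w →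
      ¬ (x ≡ i × y ≡ suc i) → ¬ (x ≡ suc i × y ≡ i) →
      ¬ (x ≡ suc (m + j) × y ≡ suc (m + suc j)) → ¬ (x ≡ suc (m + suc j) × y ≡ suc (m + j)) →
      (ε ≡ 1 → ¬ (x ≡ i × y ≡ suc (m + j))) →
      φ x kx ≤ w + φ y ky
    φ-feasible x y (pathA hx) (pathA hy) w e ¬Aᵢ ¬Aᵢ′ _ _ _ with pathEdge-inv x y e
    ... | refl , inj₁ refl = φ-A-suc x hx hy (λ x≡i → ¬Aᵢ (x≡i , cong suc x≡i))
    ... | refl , inj₂ refl = φ-A-pred y hx hy (λ y≡i → ¬Aᵢ′ (cong suc y≡i , y≡i))
    φ-feasible x y (pathA hx) (pathB q hq refl) w e _ _ _ _ ¬aᵢbⱼ with crossEdge-inv full x q e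
    ... | refl , _ = φ-cross-AB x q y hx hq refl
                       (λ ε≡1 (x≡i , q≡j) → ¬aᵢbⱼ ε≡1 (x≡i , cong (λ z → suc (m + z)) q≡j))
    φ-feasible x y (pathB q hq refl) (pathA hy) w e _ _ _ _ _ with crossEdge-inv full y q e
    ... | refl , _ , q<m = φ-cross-BA q y x hy hq refl q<m
    φ-feasible x y (pathB q hq refl) (pathB q′ hq′ refl) w e _ _ ¬Bⱼ ¬Bⱼ′ _ with pathEdge-inv q q′ e
    ... | refl , inj₁ refl = φ-B-suc q x y hq hq′ refl refl (λ { refl → ¬Bⱼ (refl , refl) })
    ... | refl , inj₂ refl = φ-B-pred q′ x y hq hq′ refl refl (λ { refl → ¬Bⱼ′ (refl , refl) })

  entry : Vec (Vec Bool m) m → CrossPattern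
  entry rows p q = lookupOr false (lookupOr (Vec.replicate m false) rows p) q

  entry-injective : ∀ rows rows′ → (∀ p q → p < m → q < m → entry rows p q ≡ entry rows′ p q) → rows ≡ rows′
  entry-injective rows rows′ same = lookupOr-injective _ rows rows′ λ p p<m →
    lookupOr-injective false _ _ λ q q<m → same p q p<m q<m

  A<B : ∀ {x} q → x ≤ m → x < suc (m + q)
  A<B q x≤m = s≤s (≤-trans x≤m (m≤m+n m q))

  -- Labels above 2m + 1 are isolated vertices.
  module OnVertices (n : ℕ) (2m+2≤n : suc m + suc m ≤ n) where

    vA : ∀ x → .(x ≤ m) → Fin n
    vA x x≤m = fromℕ< (≤-trans (s≤s x≤m) (≤-trans (m≤m+n (suc m) (suc m)) 2m+2≤n))

    vB : ∀ q → .(q ≤ m) → Fin n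
    vB q q≤m = fromℕ< (≤-trans (s≤s (s≤s (+-monoʳ-≤ m q≤m)))
                               (≤-trans (≤-reflexive (cong suc (sym (+-suc m m)))) 2m+2≤n))

    toℕ-vA : ∀ x .(h : x ≤ m) → toℕ (vA x h) ≡ x
    toℕ-vA x h = toℕ-fromℕ< _

    toℕ-vB : ∀ q .(h : q ≤ m) → toℕ (vB q h) ≡ suc (m + q)
    toℕ-vB q h = toℕ-fromℕ< _

    G : CrossPattern → Graph n
    G c u v = edge c (toℕ u) (toℕ v) (kind (toℕ u)) (kind (toℕ v))

    G-at : ∀ c u v {x y r} → toℕ u ≡ x → toℕ v ≡ y → edge c x y (kind x) (kind y) ≡ r → G c u v ≡ r
    G-at c u v refl refl e = e

    G-undirected : ∀ c → Undirected (G c)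
    G-undirected c = record
      { symmetric = λ u v → edge-sym c _ _ (kind (toℕ u)) (kind (toℕ v))
      ; loopless  = λ u → edge-irrefl c _ (kind (toℕ u)) (kind (toℕ u))
      ; positive  = λ u v w e → proj₁ (edge-weight c _ _ (kind (toℕ u)) (kind (toℕ v)) e)
      }

    G-weights : ∀ {Wmax} c → maxWeight ≤ Wmax → WeightsBoundedBy Wmax (G c)
    G-weights c maxWeight≤Wmax u v w e =
      ≤-trans (proj₂ (edge-weight c _ _ (kind (toℕ u)) (kind (toℕ v)) e)) maxWeight≤Wmax

    G-⊆-full : ∀ c u v w → G c u v ≡ just w → G full u v ≡ just w
    G-⊆-full c u v w = edge-⊆-full c _ _ (kind (toℕ u)) (kind (toℕ v))

    s t : Fin n
    s = vA 0 z≤n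
    t = vB 0 z≤n

    module Faults (i j : ℕ) (i<m : i < m) (j<m : j < m) where

      aᵢ aᵢ₊₁ bⱼ bⱼ₊₁ : Fin n
      aᵢ   = vA i (<⇒≤ i<m)
      aᵢ₊₁ = vA (suc i) i<m
      bⱼ   = vB j (<⇒≤ j<m)
      bⱼ₊₁ = vB (suc j) j<m

      toℕ-aᵢ : toℕ aᵢ ≡ i
      toℕ-aᵢ = toℕ-vA i (<⇒≤ i<m)
      toℕ-aᵢ₊₁ : toℕ aᵢ₊₁ ≡ suc i
      toℕ-aᵢ₊₁ = toℕ-vA (suc i) i<m
      toℕ-bⱼ : toℕ bⱼ ≡ suc (m + j)
      toℕ-bⱼ = toℕ-vB j (<⇒≤ j<m)
      toℕ-bⱼ₊₁ : toℕ bⱼ₊₁ ≡ suc (m + suc j)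
      toℕ-bⱼ₊₁ = toℕ-vB (suc j) j<m

      faults : FaultSet n
      faults = (aᵢ , aᵢ₊₁) ∷ (bⱼ , bⱼ₊₁) ∷ []

      faults-valid : ∀ c → ValidFaults (G c) faults
      faults-valid c = s≤s (s≤s z≤n) ,
        (1 , G-at c aᵢ aᵢ₊₁ toℕ-aᵢ toℕ-aᵢ₊₁ (edge-A-suc c i (kind _) (kind _) i<m)) ∷
        (1 , G-at c bⱼ bⱼ₊₁ toℕ-bⱼ toℕ-bⱼ₊₁
               (trans (edge-B c j (suc j) (kind _) (kind _) (<⇒≤ j<m) j<m) (pathEdge-suc j))) ∷ []

      miss⇒≢fault : ∀ {u v a b x y} → hits faults u v ≡ false → (a , b) ∈ faults ⊎ (b , a) ∈ faults →
              toℕ a ≡ x → toℕ b ≡ y → ¬ (toℕ u ≡ x × toℕ v ≡ y)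
      miss⇒≢fault miss ab∈ refl refl (u≡a , v≡b) with toℕ-injective u≡a | toℕ-injective v≡b
      ... | refl | refl with () ← trans (sym miss) (hits-∈ ab∈)

      ≢faults⇒miss : ∀ {u v x y} → toℕ u ≡ x → toℕ v ≡ y →
               (x ≢ i ⊎ y ≢ suc i) → (x ≢ suc i ⊎ y ≢ i) →
               (x ≢ suc (m + j) ⊎ y ≢ suc (m + suc j)) → (x ≢ suc (m + suc j) ⊎ y ≢ suc (m + j)) →
               hits faults u v ≡ false
      ≢faults⇒miss refl refl p₁ p₂ p₃ p₄ = hits-∉
        ( (differs toℕ-aᵢ toℕ-aᵢ₊₁ p₁ , differs toℕ-aᵢ toℕ-aᵢ₊₁ (Sum.swap p₂))
        ∷ (differs toℕ-bⱼ toℕ-bⱼ₊₁ p₃ , differs toℕ-bⱼ toℕ-bⱼ₊₁ (Sum.swap p₄))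
        ∷ [])
        where
        differs : ∀ {u v a b x y} → toℕ a ≡ x → toℕ b ≡ y → toℕ u ≢ x ⊎ toℕ v ≢ y → (u , v) ≢ (a , b)
        differs refl refl (inj₁ u≢a) refl = u≢a refl
        differs refl refl (inj₂ v≢b) refl = v≢b refl

      W : ℕ
      W = crossWeight i j

      walk-≥ : ∀ ε → ε ≤ 1 → (K : Graph n) → (∀ u v w → K u v ≡ just w → G full u v ≡ just w) →
               (ε ≡ 1 → K aᵢ bⱼ ≡ nothing) → ∀ {d} → Walk (K ∖ faults) s t d → i + (W + j) + ε ≤ d
      walk-≥ ε ε≤1 K K⊆G ¬aᵢbⱼ {d} walk = begin
        i + (W + j) + ε  ≡⟨ φ-s (toℕ-vA 0 z≤n) (kind _) ⟨
        φᵥ s             ≤⟨ feasible⇒walk-≥ feasible walk ⟩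
        d + φᵥ t         ≡⟨ cong (d +_) (φ-t (toℕ-vB 0 z≤n) (kind _)) ⟩
        d + 0            ≡⟨ +-identityʳ d ⟩
        d                ∎
        where
        open ≤-Reasoning
        open Potential i j ε i<m j<m ε≤1 using (φ; φ-feasible)

        φᵥ : Fin n → ℕ
        φᵥ u = φ (toℕ u) (kind (toℕ u))

        φ-s : ∀ {x} → x ≡ 0 → (k : Kind x) → φ x k ≡ i + (W + j) + ε
        φ-s refl (pathA _)          = refl
        φ-s refl (pathB _ _ ())
        φ-s refl (isolated 0≰m _)   = contradiction z≤n 0≰m

        φ-t : ∀ {x} → x ≡ suc (m + 0) → (k : Kind x) → φ x k ≡ 0
        φ-t refl (pathA x≤m)         = contradiction refl (A-B-disjoint x≤m)
        φ-t refl (pathB q _ e)       with B-label-injective e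
        ... | refl = refl
        φ-t refl (isolated _ q≰m)    = contradiction (B-label-∸ z≤n) q≰m

        feasible : Feasible (K ∖ faults) φᵥ
        feasible u v w e with ∖-edge⁻ K faults u v e
        ... | miss , Kuv = φ-feasible (toℕ u) (toℕ v) (kind (toℕ u)) (kind (toℕ v)) w (K⊆G u v w Kuv)
          (miss⇒≢fault miss (inj₁ (here refl)) toℕ-aᵢ toℕ-aᵢ₊₁)
          (miss⇒≢fault miss (inj₂ (here refl)) toℕ-aᵢ₊₁ toℕ-aᵢ)
          (miss⇒≢fault miss (inj₁ (there (here refl))) toℕ-bⱼ toℕ-bⱼ₊₁)
          (miss⇒≢fault miss (inj₂ (there (here refl))) toℕ-bⱼ₊₁ toℕ-bⱼ)
          (λ ε≡1 (u≡ , v≡) → uncrossed ε≡1 (toℕ-injective (trans u≡ (sym toℕ-aᵢ)))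
                                          (toℕ-injective (trans v≡ (sym toℕ-bⱼ))))
          where
          uncrossed : ε ≡ 1 → u ≡ aᵢ → v ≡ bⱼ → ⊥
          uncrossed ε≡1 refl refl with () ← trans (sym Kuv) (¬aᵢbⱼ ε≡1)

      module ShortestWalk (c : CrossPattern) (cᵢⱼ : c i j ≡ true) where

        K : Graph n
        K = G c ∖ faults

        step : ∀ {u v x y w d} → toℕ u ≡ x → toℕ v ≡ y → hits faults u v ≡ false →
               edge c x y (kind x) (kind y) ≡ just w → Walk K v t d → Walk K u t (w + d)
        step {u} {v} u≡x v≡y miss e walk = ∖-edge⁺ (G c) faults u v miss (G-at c u v u≡x v≡y e) ∷ walk

        down-B : ∀ q (q≤j : q ≤ j) → Walk K (vB q (≤-trans q≤j (<⇒≤ j<m))) t q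
        down-B zero    _   = []
        down-B (suc q) q<j = step (toℕ-vB (suc q) 1+q≤m) (toℕ-vB q q≤m)
          (≢faults⇒miss (toℕ-vB (suc q) 1+q≤m) (toℕ-vB q q≤m)
            (inj₁ (>⇒≢ (A<B (suc q) (<⇒≤ i<m))))
            (inj₁ (>⇒≢ (A<B (suc q) i<m)))
            (inj₂ (<⇒≢ (s≤s (+-monoʳ-< m (≤-trans q<j (n≤1+n j))))))
            (inj₁ (<⇒≢ (s≤s (+-monoʳ-< m (s≤s q<j))))))
          (trans (edge-B c (suc q) q (kind _) (kind _) 1+q≤m q≤m) (pathEdge-pred q))
          (down-B q (<⇒≤ q<j))
          where
          1+q≤m : suc q ≤ m
          1+q≤m = ≤-trans q<j (<⇒≤ j<m)
          q≤m : q ≤ m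
          q≤m = <⇒≤ 1+q≤m

        along-A : ∀ k p (k+p≡i : k + p ≡ i) →
                  Walk K (vA p (≤-trans (m≤n+m p k) (≤-trans (≤-reflexive k+p≡i) (<⇒≤ i<m)))) t (k + (W + j))
        along-A zero p refl = step (toℕ-vA p (<⇒≤ i<m)) toℕ-bⱼ
          (≢faults⇒miss (toℕ-vA p (<⇒≤ i<m)) toℕ-bⱼ
            (inj₂ (>⇒≢ (A<B j i<m)))
            (inj₁ (<⇒≢ (n<1+n p)))
            (inj₁ (<⇒≢ (A<B j (<⇒≤ i<m))))
            (inj₁ (<⇒≢ (A<B (suc j) (<⇒≤ i<m)))))
          (trans (edge-cross c p j (kind _) (kind _) i<m j<m) (crossEdge-present c p j cᵢⱼ i<m j<m))
          (down-B j ≤-refl)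
        along-A (suc k) p k+p≡i = step (toℕ-vA p p≤m) (toℕ-vA (suc p) 1+p≤m)
          (≢faults⇒miss (toℕ-vA p p≤m) (toℕ-vA (suc p) 1+p≤m)
            (inj₁ (<⇒≢ p<i)) (inj₁ (<⇒≢ (≤-trans p<i (n≤1+n i))))
            (inj₁ (<⇒≢ (A<B j p≤m))) (inj₁ (<⇒≢ (A<B (suc j) p≤m))))
          (edge-A-suc c p (kind _) (kind _) 1+p≤m)
          (along-A k (suc p) (trans (+-suc k p) k+p≡i))
          where
          p<i : p < i
          p<i = ≤-trans (s≤s (m≤n+m p k)) (≤-reflexive k+p≡i)
          1+p≤m : suc p ≤ m
          1+p≤m = ≤-trans p<i (<⇒≤ i<m)
          p≤m : p ≤ m
          p≤m = <⇒≤ 1+p≤m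

        shortest : Walk K s t (i + (W + j))
        shortest = along-A i 0 (+-identityʳ i)

        dist : IsDist K s t (just (i + (W + j)))
        dist = shortest , λ d walk →
          subst (_≤ d) (+-identityʳ _) (walk-≥ 0 z≤n (G c) (G-⊆-full c) (λ ()) walk)

      no-short-walk : (K : Graph n) → (∀ u v w → K u v ≡ just w → G full u v ≡ just w) →
                      K aᵢ bⱼ ≡ nothing → ¬ Walk (K ∖ faults) s t (i + (W + j))
      no-short-walk K K⊆G ¬aᵢbⱼ walk =
        1+n≰n (subst (_≤ i + (W + j)) (+-comm (i + (W + j)) 1) (walk-≥ 1 ≤-refl K K⊆G (λ _ → ¬aᵢbⱼ) walk))

      preserver-has-cross-edge : ∀ H → TwoFTPreserver (G full) s t H → ∃ λ w → H aᵢ bⱼ ≡ just w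
      preserver-has-cross-edge H (_ , H⊆G , preserves) with H aᵢ bⱼ in Haᵢbⱼ
      ... | just w  = w , refl
      ... | nothing = contradiction
            (proj₁ (preserves faults (faults-valid full) _ (ShortestWalk.dist full refl)))
            (no-short-walk H H⊆G Haᵢbⱼ)

      module _ {Wmax : ℕ} (O : TwoFTOracle n Wmax s t) where
        open TwoFTOracle O

        answer : CrossPattern → Maybe ℕ
        answer c = query (encode (G c)) faults

        answer-if-present : ∀ c → WeightsBoundedBy Wmax (G c) → c i j ≡ true →
                            answer c ≡ just (i + (W + j))
        answer-if-present c bounded cᵢⱼ =
          IsDist-minimal-walk (correct (G c) (G-undirected c) bounded faults (faults-valid c))
                              (proj₁ (dist c cᵢⱼ)) (proj₂ (dist c cᵢⱼ))
          where open ShortestWalk using (dist)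

        present-if-answer : ∀ c → WeightsBoundedBy Wmax (G c) → answer c ≡ just (i + (W + j)) →
                            c i j ≡ true
        present-if-answer c bounded answered with c i j in cᵢⱼ
        ... | true  = refl
        ... | false = contradiction
              (proj₁ (subst (IsDist (G c ∖ faults) s t) answered
                            (correct (G c) (G-undirected c) bounded faults (faults-valid c))))
              (no-short-walk (G c) (G-⊆-full c)
                 (G-at c aᵢ bⱼ toℕ-aᵢ toℕ-bⱼ
                    (trans (edge-cross c i j (kind _) (kind _) i<m j<m) (crossEdge-absent c i j cᵢⱼ))))

        encode-determines : ∀ c c′ → WeightsBoundedBy Wmax (G c) → WeightsBoundedBy Wmax (G c′) →
                            encode (G c) ≡ encode (G c′) → c i j ≡ c′ i j
        encode-determines c c′ bounded bounded′ same with c i j in cᵢⱼ | c′ i j in c′ᵢⱼ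
        ... | true  | true  = refl
        ... | false | false = refl
        ... | true  | false = trans (sym (present-if-answer c′ bounded′
                (trans (cong (λ code → query code faults) (sym same)) (answer-if-present c bounded cᵢⱼ)))) c′ᵢⱼ
        ... | false | true  = trans (sym cᵢⱼ) (present-if-answer c bounded
                (trans (cong (λ code → query code faults) same) (answer-if-present c′ bounded′ c′ᵢⱼ)))

    preserver-size : ∀ H → TwoFTPreserver (G full) s t H → m * m ≤ edgeCount H
    preserver-size H preserver =
      edgeCount-≥-intervals H 0 m (suc m) m (n≤1+n m) (≤-trans (+-monoʳ-≤ (suc m) (n≤1+n m)) 2m+2≤n) adjacent
      where
      adjacent : ∀ u v → toℕ u < m → suc m ≤ toℕ v → toℕ v < suc m + m → IsEdge H (u , v)
      adjacent u v u<m m<v v< =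
        subst₂ (λ x y → IsEdge H (x , y)) (sym u≡aᵢ) (sym v≡bⱼ) (preserver-has-cross-edge H preserver)
        where
        q : ℕ
        q = toℕ v ∸ suc m
        v-label : suc (m + q) ≡ toℕ v
        v-label = m+[n∸m]≡n m<v
        q<m : q < m
        q<m = +-cancelˡ-< (suc m) q m (subst (_< suc m + m) (sym v-label) v<)
        open Faults (toℕ u) q u<m q<m using (aᵢ; bⱼ; toℕ-aᵢ; toℕ-bⱼ; preserver-has-cross-edge)
        u≡aᵢ : u ≡ aᵢ
        u≡aᵢ = toℕ-injective (sym toℕ-aᵢ)
        v≡bⱼ : v ≡ bⱼ
        v≡bⱼ = toℕ-injective (trans (sym v-label) (sym toℕ-bⱼ))

    oracle-size : ∀ {Wmax} → maxWeight ≤ Wmax → (O : TwoFTOracle n Wmax s t) →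
                  ∃ λ c → m * m ≤ length (TwoFTOracle.encode O (G c))
    oracle-size {Wmax} maxWeight≤Wmax O =
      let rows , long = injective⇒long-image (m * m) code code-injective matrices
                          (vectors-unique m (vectors-unique m bools-unique)) enough
      in entry rows , long
      where
      bools : List Bool
      bools = true ∷ false ∷ []
      bools-unique : Unique bools
      bools-unique = ((λ ()) ∷ []) ∷ ([] ∷ [])
      matrices : List (Vec (Vec Bool m) m)
      matrices = vectors (vectors bools m) m
      enough : 2 ^ (m * m) ≤ length matrices
      enough = ≤-reflexive (begin
        2 ^ (m * m)                    ≡⟨ ^-*-assoc 2 m m ⟨
        (2 ^ m) ^ m                    ≡⟨ cong (_^ m) (length-vectors bools m) ⟨
        length (vectors bools m) ^ m   ≡⟨ length-vectors (vectors bools m) m ⟨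
        length matrices                ∎)
        where open ≡-Reasoning
      code : Vec (Vec Bool m) m → List Bool
      code rows = TwoFTOracle.encode O (G (entry rows))
      code-injective : Injective _≡_ _≡_ code
      code-injective same = entry-injective _ _ λ p q p<m q<m →
        Faults.encode-determines p q p<m q<m O _ _ (G-weights _ maxWeight≤Wmax) (G-weights _ maxWeight≤Wmax) same

-- Choosing m ≈ n / 2

halve : ∀ n → 4 ≤ n → ∃ λ m → 1 ≤ m × suc m + suc m ≤ n × n ≤ suc (suc m + suc m)
halve 0 ()
halve 1 (s≤s ())
halve 2 (s≤s (s≤s ()))
halve 3 (s≤s (s≤s (s≤s ())))
halve 4 _ = 1 , ≤-refl , ≤-refl , n≤1+n 4
halve 5 _ = 1 , ≤-refl , n≤1+n 4 , ≤-refl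
halve (suc (suc n@(suc (suc (suc (suc _)))))) _ with halve n (s≤s (s≤s (s≤s (s≤s z≤n))))
... | m , 1≤m , 2m+2≤n , n≤2m+3 = suc m , s≤s z≤n ,
      subst (_≤ suc (suc n)) (cong suc (sym (+-suc (suc m) (suc m)))) (s≤s (s≤s 2m+2≤n)) ,
      subst (suc (suc n) ≤_) (cong (λ k → suc (suc k)) (sym (+-suc (suc m) (suc m)))) (s≤s (s≤s n≤2m+3))

n²≤25m² : ∀ m n → 1 ≤ m → n ≤ suc (suc m + suc m) → n * n ≤ 25 * (m * m)
n²≤25m² (suc k) n _ n≤2m+3 =
  ≤-trans (*-mono-≤ n≤2m+3 n≤2m+3) (≤-trans (m≤m+n _ (21 * (k * k) + 30 * k)) (≤-reflexive (expand k)))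
  where
  expand : ∀ k → (1 + ((2 + k) + (2 + k))) * (1 + ((2 + k) + (2 + k))) + (21 * (k * k) + 30 * k) ≡
                 25 * ((1 + k) * (1 + k))
  expand = solve-∀

maxWeight-≤-n² : ∀ m n → 1 ≤ m → suc m + suc m ≤ n → LowerBoundGraph.maxWeight m ≤ n ^ 2
maxWeight-≤-n² (suc k) n _ 2m+2≤n = begin
  1 + 6 * (1 + k) + 2 * (1 + k) + 2 * (1 + k)  ≤⟨ m≤m+n _ (4 * (k * k) + 6 * k + 5) ⟩
  _                                             ≡⟨ expand k ⟩
  ((2 + k) + (2 + k)) * ((2 + k) + (2 + k))     ≤⟨ *-mono-≤ 2m+2≤n 2m+2≤n ⟩
  n * n                                         ≡⟨ cong (n *_) (*-identityʳ n) ⟨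
  n ^ 2                                         ∎
  where
  open ≤-Reasoning
  expand : ∀ k → (1 + 6 * (1 + k) + 2 * (1 + k) + 2 * (1 + k)) + (4 * (k * k) + 6 * k + 5) ≡
                 ((2 + k) + (2 + k)) * ((2 + k) + (2 + k))
  expand = solve-∀

preserver-lower-bound : ∀ n → 4 ≤ n → Σ (Graph n) λ G → Undirected G × (Σ (Fin n) λ s → Σ (Fin n) λ t →
                        ∀ H → TwoFTPreserver G s t H → n * n ≤ 25 * edgeCount H)
preserver-lower-bound n 4≤n with halve n 4≤n
... | m , 1≤m , 2m+2≤n , n≤2m+3 = G full , G-undirected full , s , t , λ H preserver →
      ≤-trans (n²≤25m² m n 1≤m n≤2m+3) (*-monoʳ-≤ 25 (preserver-size H preserver))
  where open LowerBoundGraph.OnVertices m n 2m+2≤n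

oracle-lower-bound : ∀ n → 4 ≤ n → Σ (Fin n) λ s → Σ (Fin n) λ t → (O : TwoFTOracle n (n ^ 2) s t) →
                     Σ (Graph n) λ G → Undirected G × WeightsBoundedBy (n ^ 2) G ×
                       n * n ≤ 25 * length (TwoFTOracle.encode O G)
oracle-lower-bound n 4≤n with halve n 4≤n
... | m , 1≤m , 2m+2≤n , n≤2m+3 = s , t , λ O →
      let c , long = oracle-size maxWeight≤n² O
      in G c , G-undirected c , G-weights c maxWeight≤n² , ≤-trans (n²≤25m² m n 1≤m n≤2m+3) (*-monoʳ-≤ 25 long)
  where
  open LowerBoundGraph.OnVertices m n 2m+2≤n
  maxWeight≤n² : LowerBoundGraph.maxWeight m ≤ n ^ 2
  maxWeight≤n² = maxWeight-≤-n² m n 1≤m 2m+2≤n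

theorem9 : (Σ ℕ λ c → Σ ℕ λ n₀ → ∀ n → n₀ ≤ n →
    Σ (Graph n) λ G → Undirected G × (Σ (Fin n) λ s → Σ (Fin n) λ t →
    ∀ H → TwoFTPreserver G s t H → n * n ≤ c * edgeCount H))
    ×
    (Σ ℕ λ c → Σ ℕ λ k → Σ ℕ λ n₀ → ∀ n → n₀ ≤ n →
    Σ (Fin n) λ s → Σ (Fin n) λ t → (O : TwoFTOracle n (n ^ k) s t) →
    Σ (Graph n) λ G → Undirected G × WeightsBoundedBy (n ^ k) G ×
    n * n ≤ c * length (TwoFTOracle.encode O G))
theorem9 = (25 , 4 , preserver-lower-bound) , (25 , 2 , 4 , oracle-lower-bound)
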